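{- Define $\Phi:\mathcal P(\mathcal P(\mathcal T))\to\mathcal P(\mathbf E_{\mathrm{fin}})$ by $\Phi(K):=\{E(\mathcal W):\mathcal W\subseteq K,\ \mathcal W\text{ finite}\}$ and $\Delta:\mathcal P(\mathbf E_{\mathrm{fin}})\to\mathcal P(\mathcal P(\mathcal T))$ by $\Delta(\mathcal F):=\{S\subseteq\mathcal T:\overline{\mathbf D}_S\in\mathcal F\}$. Then for all SDSes $K,K_1,K_2\subseteq\mathcal P(\mathcal T)$ and all $\mathcal F,\mathcal F_1,\mathcal F_2\subseteq\mathbf E_{\mathrm{fin}}$: (i) if $K$ is a finitely coherent SDS then $\Phi(K)$ is a proper filter on $(\mathbf E_{\mathrm{fin}},\subseteq)$; (ii) if $\mathcal F$ is a proper filter on $(\mathbf E_{\mathrm{fin}},\subseteq)$ then $\Delta(\mathcal F)$ is a finitely coherent SDS; (iii) if $K$ is a finitely coherent SDS then $\Delta(\Phi(K))=K$; (iv) if $\mathcal F$ is a proper filter on $(\mathbf E_{\mathrm{fin}},\subseteq)$ then $\Phi(\Delta(\mathcal F))=\mathcal F$; (v) if $K_1\subseteq K_2$ then $\Phi(K_1)\subseteq\Phi(K_2)$; (vi) if $\mathcal F_1\subseteq\mathcal F_2$ then $\Delta(\mathcal F_1)\subseteq\Delta(\mathcal F_2)$; (vii) $\Phi(\{S\subseteq\mathcal T:S\cap\mathcal T_+\neq\emptyset\})=\{\overline{\mathbf D}\}$ and $\Phi(\mathcal P(\mathcal T))=\mathbf E_{\mathrm{fin}}$; (viii) $\Delta(\{\overline{\mathbf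 D}\})=\{S\subseteq\mathcal T:S\cap\mathcal T_+\neq\emptyset\}$ and $\Delta(\mathbf E_{\mathrm{fin}})=\mathcal P(\mathcal T)$. Hence $\Phi$ is an order isomorphism between $(\mathbf K_{\mathrm{fin}},\subseteq)$, where $\mathbf K_{\mathrm{fin}}$ is the set of all finitely coherent SDSes together with $\mathcal P(\mathcal T)$, and the set $(\mathbf F(\mathbf E_{\mathrm{fin}}),\subseteq)$ of all filters on $(\mathbf E_{\mathrm{fin}},\subseteq)$, with inverse $\Delta$. Moreover, (ix) if a proper filter $\mathcal F$ and a finitely coherent SDS $K$ satisfy $\mathcal F=\Phi(K)$ and $K=\Delta(\mathcal F)$, then $\mathcal F$ is a prime filter on $(\mathbf E_{\mathrm{fin}},\subseteq)$ if and only if $K$ is complete, i.e. for all $S_1,S_2\subseteq\mathcal T$, $S_1\cup S_2\in K$ implies $S_1\in K$ or $S_2\in K$.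
   Context: Let $\mathcal T$ be a non-empty set (of "things"), $\mathrm{cl}:\mathcal P(\mathcal T)\to\mathcal P(\mathcal T)$ a closure operator (extensive, monotone, idempotent), $\mathcal T_-\subseteq\mathcal T$ a set of forbidden things, $\mathcal T_+:=\mathrm{cl}(\emptyset)$, with standing assumption $\mathcal T_+\cap\mathcal T_-=\emptyset$. A coherent SDT is a $D\subseteq\mathcal T$ with $\mathrm{cl}(D)=D$ and $D\cap\mathcal T_-=\emptyset$; $\overline{\mathbf D}$ is the set of all coherent SDTs. For $\mathcal W\subseteq\mathcal P(\mathcal T)$, $\Sigma_{\mathcal W}$ is the set of maps $\sigma:\mathcal W\to\mathcal T$ with $\sigma(S)\in S$ for all $S\in\mathcal W$, and $\sigma(\mathcal W):=\{\sigma(S):S\in\mathcal W\}$. An SDS is any $K\subseteq\mathcal P(\mathcal T)$. It is finitely coherent if (K1) $\emptyset\notin K$; (K2) if $S_1\in K$ and $S_1\subseteq S_2\subseteq\mathcal T$ then $S_2\in K$; (K3) if $S\in K$ then $S\setminus\mathcal T_-\in K$; (K4) $\{t\}\in K$ for all $t\in\mathcal T_+$; (K5fin) for every non-empty finite $\mathcal W\subseteq K$ and every family $(t_\sigma)_{\sigma\in\Sigma_{\mathcal W}}$ with $t_\sigma\in\mathrm{cl}(\sigma(\mathcal W))$, $\{t_\sigma:\sigma\in\Sigma_{\mathcal W}\}\in K$. For $S\subseteq\mathcal T$ let $\overline{\mathbf D}_S:=\{D\in\overline{\mathbf D}:S\cap D\neq\emptyset\}$, for $\mathcal W\subseteq\mathcal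 P(\mathcal T)$ let $E(\mathcal W):=\bigcap_{S\in\mathcal W}\overline{\mathbf D}_S$ (with $E(\emptyset)=\overline{\mathbf D}$), and $\mathbf E_{\mathrm{fin}}:=\{E(\mathcal W):\mathcal W\subseteq\mathcal P(\mathcal T)\text{ finite}\}$, ordered by inclusion (a bounded distributive lattice with union as join, intersection as meet, bottom $\emptyset$, top $\overline{\mathbf D}$). A filter on a bounded lattice $(L,\le)$ is a non-empty $\mathcal F\subseteq L$ such that $a\in\mathcal F,a\le b\Rightarrow b\in\mathcal F$ and $a,b\in\mathcal F\Rightarrow a\wedge b\in\mathcal F$; it is proper if $\mathcal F\neq L$; a prime filter is a proper filter with $a\vee b\in\mathcal F\Rightarrow(a\in\mathcal F$ or $b\in\mathcal F)$. -}

module Defs where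

open import Level using (Level; 0ℓ; Lift) renaming (suc to lsuc)
open import Data.Empty using (⊥)
open import Data.Unit using (⊤)
open import Data.Nat using (ℕ; suc)
open import Data.Fin using (Fin)
open import Data.Product using (Σ; ∃; ∃-syntax; _×_; _,_; proj₁)
open import Data.Sum using (_⊎_)
open import Relation.Nullary using (¬_)
open import Relation.Binary.PropositionalEquality using (_≡_)
open import Relation.Unary using (Pred; _⊆_; _≐_; _∩_; _∪_; ∅; ｛_｝; _∖_; Satisfiable)

1ℓ : Level
1ℓ = lsuc 0ℓ

record Setup : Set₁ where
  field
    Thing     : Set
    inhabited : Thing
    cl        : Pred Thing 0ℓ → Pred Thing 0ℓ
    cl-extensive : ∀ A → A ⊆ cl A
    cl-monotone  : ∀ A B → A ⊆ B → cl A ⊆ cl B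
    cl-idempotent : ∀ A → cl (cl A) ≐ cl A
    Forbidden : Pred Thing 0ℓ
    disjoint  : ∀ t → cl ∅ t → Forbidden t → ⊥

module _ (𝒮 : Setup) where
  open Setup 𝒮

  Subset : Set₁
  Subset = Pred Thing 0ℓ

  T₊ : Subset
  T₊ = cl ∅

  IsCoherentSDT : Subset → Set
  IsCoherentSDT D = (cl D ≐ D) × (∀ t → D t → Forbidden t → ⊥)

  DSet : Set₁
  DSet = Pred Subset 0ℓ

  Dbar : DSet
  Dbar = IsCoherentSDT

  DbarOf : Subset → DSet
  DbarOf S D = IsCoherentSDT D × Satisfiable (S ∩ D)

  -- A finite 𝒲 ⊆ 𝒫(𝒯) is given as an enumeration W : Fin n → Subset.
  -- E(𝒲) = ⋂_{S ∈ 𝒲} 𝐃̄_S, with E(∅) = 𝐃̄ (the 𝐃̄ conjunct is redundant for n > 0)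
  E : ∀ {n} → (Fin n → Subset) → DSet
  E W D = Dbar D × (∀ i → DbarOf (W i) D)

  SDS : Set₂
  SDS = Pred Subset 1ℓ

  Coll : Set₂
  Coll = Pred DSet 1ℓ

  -- 𝐄_fin = {E(𝒲) : 𝒲 ⊆ 𝒫(𝒯) finite}  (membership up to extensional equality)
  Efin : Coll
  Efin 𝔈 = ∃[ n ] Σ (Fin n → Subset) λ W → 𝔈 ≐ E W

  Φ : SDS → Coll
  Φ K 𝔈 = ∃[ n ] Σ (Fin n → Subset) λ W → (∀ i → K (W i)) × (𝔈 ≐ E W)

  Δ : Coll → SDS
  Δ 𝓕 S = 𝓕 (DbarOf S)

  AllSubsets : SDS
  AllSubsets _ = Lift 1ℓ ⊤

  MeetsT₊ : SDS
  MeetsT₊ S = Lift 1ℓ (Satisfiable (S ∩ T₊))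

  SingletonDbar : Coll
  SingletonDbar 𝔈 = 𝔈 ≐ Dbar

  Choice : ∀ {n} → (Fin n → Subset) → Set
  Choice {n} W = (i : Fin n) → Σ Thing (W i)

  image : ∀ {n} {W : Fin n → Subset} → Choice W → Subset
  image σ t = ∃[ i ] t ≡ proj₁ (σ i)

  K1 K2 K3 K4 K5fin : SDS → Set₁
  K1 K = ¬ K ∅
  K2 K = ∀ S₁ S₂ → K S₁ → S₁ ⊆ S₂ → K S₂
  K3 K = ∀ S → K S → K (S ∖ Forbidden)
  K4 K = ∀ t → T₊ t → K ｛ t ｝
  K5fin K = ∀ n (W : Fin (suc n) → Subset) → (∀ i → K (W i)) →
            (f : Choice W → Thing) → (∀ σ → cl (image σ) (f σ)) →
            K (λ x → ∃[ σ ] x ≡ f σ)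

  FinitelyCoherent : SDS → Set₁
  FinitelyCoherent K = K1 K × K2 K × K3 K × K4 K × K5fin K

  Complete : SDS → Set₁
  Complete K = ∀ S₁ S₂ → K (S₁ ∪ S₂) → K S₁ ⊎ K S₂

  IsFilter : Coll → Set₁
  IsFilter 𝓕 = (𝓕 ⊆ Efin)
             × Satisfiable 𝓕
             × (∀ a b → 𝓕 a → Efin b → a ⊆ b → 𝓕 b)
             × (∀ a b → 𝓕 a → 𝓕 b → 𝓕 (a ∩ b))

  IsProperFilter : Coll → Set₁
  IsProperFilter 𝓕 = IsFilter 𝓕 × ¬ (Efin ⊆ 𝓕)

  IsPrimeFilter : Coll → Set₁
  IsPrimeFilter 𝓕 = IsProperFilter 𝓕
                  × (∀ a b → Efin a → Efin b → 𝓕 (a ∪ b) → 𝓕 a ⊎ 𝓕 b)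

  InKfin : SDS → Set₁
  InKfin K = FinitelyCoherent K ⊎ (K ≐ AllSubsets)

{-# OPTIONS --safe #-}
module Submission where

-- A finitely coherent K is closed under entailment: if W ⊆ K is finite and
-- E(W) ⊆ D̄_S then S ∈ K.  For each choice σ ∈ Σ_W, either cl(σ(W)) contains a
-- forbidden thing, or it is a coherent SDT lying in E(W) and hence meets S; K5fin
-- collects one such thing t_σ per σ, K3 discards the forbidden ones, and K2
-- enlarges the rest to S.  Closure under entailment is exactly what makes Φ(K)
-- upward closed and Δ(Φ(K)) ⊆ K; everything else is bookkeeping with
-- E(W ++ V) = E(W) ∩ E(V) and D̄_S = E([S]).  For (ix), E(W) ∪ E(V) ⊆ D̄_{W i ∪ V j},
-- so completeness gives K(W i) or K(V j) for all i, j, hence W ⊆ K or V ⊆ K.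

open import Defs
open import Level using (0ℓ; lift; lower)
open import Axiom.ExcludedMiddle using (ExcludedMiddle)
open import Data.Empty using (⊥-elim)
open import Data.Fin using (Fin; zero; suc)
open import Data.Nat using (zero; suc; _+_)
open import Data.Product using (_×_; _,_; proj₁; proj₂; ∃-syntax)
open import Data.Sum using (_⊎_; inj₁; inj₂; [_,_]; swap; fromInj₂) renaming (map to ⊎-map)
open import Data.Unit using (tt)
open import Data.Vec.Functional using (Vector; []; _++_)
open import Data.Vec.Functional.Relation.Unary.All using (All)
open import Data.Vec.Functional.Relation.Unary.All.Properties using (++⁺; ++⁻ˡ; ++⁻ʳ)
open import Function using (_∘_)
open import Function.Bundles using (_⇔_; mk⇔)
open import Relation.Nullary using (¬_; yes; no)
open import Relation.Nullary.Decidable using (map′)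
open import Relation.Binary.PropositionalEquality using (_≡_; refl)
open import Relation.Unary using (Pred; _⊆_; _≐_; _∩_; _∪_; ∅; ｛_｝; _∖_; Satisfiable)
open import Relation.Unary.Properties using (≐-refl; ≐-sym; ≐-trans)

lowerExcludedMiddle : ExcludedMiddle 1ℓ → ExcludedMiddle 0ℓ
lowerExcludedMiddle em = map′ lower lift em

∀⊎⇒∀⊎ : ∀ {n p q} {P : Fin n → Set p} {Q : Set q} → (∀ i → P i ⊎ Q) → (∀ i → P i) ⊎ Q
∀⊎⇒∀⊎ {zero} _ = inj₁ λ ()
∀⊎⇒∀⊎ {suc n} h with h zero | ∀⊎⇒∀⊎ (h ∘ suc)
... | inj₂ q  | _       = inj₂ q
... | inj₁ _  | inj₂ q  = inj₂ q
... | inj₁ p₀ | inj₁ ps = inj₁ λ { zero → p₀ ; (suc i) → ps i }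

∀∀⊎⇒∀⊎∀ : ∀ {m n p q} {P : Fin m → Set p} {Q : Fin n → Set q} →
          (∀ i j → P i ⊎ Q j) → (∀ i → P i) ⊎ (∀ j → Q j)
∀∀⊎⇒∀⊎∀ h = swap (∀⊎⇒∀⊎ λ j → swap (∀⊎⇒∀⊎ λ i → h i j))

∩-cong : ∀ {a ℓ} {A : Set a} {P₁ P₂ Q₁ Q₂ : Pred A ℓ} → P₁ ≐ P₂ → Q₁ ≐ Q₂ → P₁ ∩ Q₁ ≐ P₂ ∩ Q₂
∩-cong (P₁⊆P₂ , P₂⊆P₁) (Q₁⊆Q₂ , Q₂⊆Q₁) =
  (λ (p , q) → P₁⊆P₂ p , Q₁⊆Q₂ q) , (λ (p , q) → P₂⊆P₁ p , Q₂⊆Q₁ q)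

module Correspondence (𝒮 : Setup) where
  open Setup 𝒮

  E⊆DbarOf : ∀ {n} (W : Vector (Subset 𝒮) n) i → E 𝒮 W ⊆ DbarOf 𝒮 (W i)
  E⊆DbarOf W i (_ , meets) = meets i

  E-head-tail : ∀ {n} (W : Vector (Subset 𝒮) (suc n)) → DbarOf 𝒮 (W zero) ∩ E 𝒮 (W ∘ suc) ⊆ E 𝒮 W
  E-head-tail W (meets₀ , coherent , meets) = coherent , λ { zero → meets₀ ; (suc i) → meets i }

  E-++ : ∀ {m n} (W : Vector (Subset 𝒮) m) (V : Vector (Subset 𝒮) n) → E 𝒮 (W ++ V) ≐ E 𝒮 W ∩ E 𝒮 V
  E-++ W V = (λ {D} (coherent , meets) → (coherent , ++⁻ˡ (λ S → DbarOf 𝒮 S D) W meets)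
                                       , (coherent , ++⁻ʳ (λ S → DbarOf 𝒮 S D) W meets))
           , (λ {D} ((coherent , meetsW) , (_ , meetsV)) → coherent , ++⁺ (λ S → DbarOf 𝒮 S D) meetsW meetsV)

  DbarOf≐E : ∀ S → DbarOf 𝒮 S ≐ E 𝒮 {1} (λ _ → S)
  DbarOf≐E S = (λ meets → proj₁ meets , λ _ → meets) , (λ (_ , meets) → meets zero)

  DbarOf-mono : ∀ {S₁ S₂} → S₁ ⊆ S₂ → DbarOf 𝒮 S₁ ⊆ DbarOf 𝒮 S₂
  DbarOf-mono S₁⊆S₂ (coherent , t , s , d) = coherent , t , S₁⊆S₂ s , d

  DbarOf-∪ : ∀ S₁ S₂ → DbarOf 𝒮 (S₁ ∪ S₂) ≐ DbarOf 𝒮 S₁ ∪ DbarOf 𝒮 S₂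
  DbarOf-∪ S₁ S₂ = (λ { (c , t , inj₁ s , d) → inj₁ (c , t , s , d) ; (c , t , inj₂ s , d) → inj₂ (c , t , s , d) })
                 , [ DbarOf-mono inj₁ , DbarOf-mono inj₂ ]

  DbarOf-∖Forbidden : ∀ S → DbarOf 𝒮 S ⊆ DbarOf 𝒮 (S ∖ Forbidden)
  DbarOf-∖Forbidden S (coherent , t , s , d) = coherent , t , (s , proj₂ coherent t d) , d

  DbarOf-∅ : ∀ {D} → ¬ DbarOf 𝒮 ∅ D
  DbarOf-∅ (_ , _ , () , _)

  cl-coherent : ∀ X → (∀ t → cl X t → ¬ Forbidden t) → IsCoherentSDT 𝒮 (cl X)
  cl-coherent X allowed = cl-idempotent X , allowed

  cl-least : ∀ {X D} → IsCoherentSDT 𝒮 D → X ⊆ D → cl X ⊆ D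
  cl-least {X} {D} ((clD⊆D , _) , _) X⊆D = clD⊆D ∘ cl-monotone X D X⊆D

  T₊-coherent : IsCoherentSDT 𝒮 (T₊ 𝒮)
  T₊-coherent = cl-coherent ∅ disjoint

  DbarOf-T₊ : ∀ {S} → Satisfiable (S ∩ T₊ 𝒮) → Dbar 𝒮 ⊆ DbarOf 𝒮 S
  DbarOf-T₊ (t , s , t₊) coherent = coherent , t , s , cl-least coherent (λ ()) t₊

  Dbar⊆DbarOf⇒meetsT₊ : ∀ {S} → Dbar 𝒮 ⊆ DbarOf 𝒮 S → Satisfiable (S ∩ T₊ 𝒮)
  Dbar⊆DbarOf⇒meetsT₊ Dbar⊆ = proj₂ (Dbar⊆ T₊-coherent)

  E-meetsT₊ : ∀ {n} (W : Vector (Subset 𝒮) n) → All (λ S → Satisfiable (S ∩ T₊ 𝒮)) W → E 𝒮 W ≐ Dbar 𝒮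
  E-meetsT₊ W meets = proj₁ , λ coherent → coherent , λ i → DbarOf-T₊ (meets i) coherent

  E∈Efin : ∀ {n} (W : Vector (Subset 𝒮) n) → Efin 𝒮 (E 𝒮 W)
  E∈Efin {n} W = n , W , ≐-refl

  DbarOf∈Efin : ∀ S → Efin 𝒮 (DbarOf 𝒮 S)
  DbarOf∈Efin S = 1 , _ , DbarOf≐E S

  Dbar∈Efin : Efin 𝒮 (Dbar 𝒮)
  Dbar∈Efin = 0 , [] , ≐-sym (E-meetsT₊ [] λ ())

  Efin-resp-≐ : ∀ {𝔞 𝔟} → 𝔞 ≐ 𝔟 → Efin 𝒮 𝔞 → Efin 𝒮 𝔟
  Efin-resp-≐ 𝔞≐𝔟 (n , W , 𝔞≐E) = n , W , ≐-trans (≐-sym 𝔞≐𝔟) 𝔞≐E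

  Efin⊆Dbar : ∀ {𝔈} → Efin 𝒮 𝔈 → 𝔈 ⊆ Dbar 𝒮
  Efin⊆Dbar (_ , _ , 𝔈≐E) = proj₁ ∘ proj₁ 𝔈≐E

  choiceIn : ∀ {n} {W : Vector (Subset 𝒮) n} {D} → E 𝒮 W D → Choice 𝒮 W
  choiceIn (_ , meets) i = let t , w , _ = proj₂ (meets i) in t , w

  image-choiceIn⊆ : ∀ {n} {W : Vector (Subset 𝒮) n} {D} (d : E 𝒮 W D) → image 𝒮 (choiceIn d) ⊆ D
  image-choiceIn⊆ (_ , meets) (i , refl) = let _ , _ , d = proj₂ (meets i) in d

  cl-image∈E : ∀ {n} {W : Vector (Subset 𝒮) n} (σ : Choice 𝒮 W) →
               IsCoherentSDT 𝒮 (cl (image 𝒮 σ)) → E 𝒮 W (cl (image 𝒮 σ))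
  cl-image∈E σ coherent =
    coherent , λ i → coherent , proj₁ (σ i) , proj₂ (σ i) , cl-extensive (image 𝒮 σ) (i , refl)

  Range : ∀ {A : Set} → (A → Thing) → Subset 𝒮
  Range f t = ∃[ a ] t ≡ f a

  E⊆DbarOf-Range : ∀ {n} {W : Vector (Subset 𝒮) n} (f : Choice 𝒮 W → Thing) →
                   (∀ σ → cl (image 𝒮 σ) (f σ)) → E 𝒮 W ⊆ DbarOf 𝒮 (Range f)
  E⊆DbarOf-Range f f∈cl d = proj₁ d , f σ , (σ , refl) , cl-least (proj₁ d) (image-choiceIn⊆ d) (f∈cl σ)
    where σ = choiceIn d

  EntailmentClosed : SDS 𝒮 → Set₁
  EntailmentClosed K = ∀ {n} (W : Vector (Subset 𝒮) n) S → All K W → E 𝒮 W ⊆ DbarOf 𝒮 S → K S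

  module _ (em : ExcludedMiddle 0ℓ) where

    cl-image-meets : ∀ {n} {W : Vector (Subset 𝒮) n} {S} → E 𝒮 W ⊆ DbarOf 𝒮 S →
                     (σ : Choice 𝒮 W) → Satisfiable (cl (image 𝒮 σ) ∩ (Forbidden ∪ S))
    cl-image-meets E⊆ σ with em {Satisfiable (cl (image 𝒮 σ) ∩ Forbidden)}
    ... | yes (t , c , forbidden) = t , c , inj₁ forbidden
    ... | no allowed =
      let _ , t , s , c = E⊆ (cl-image∈E σ (cl-coherent _ λ t c forbidden → allowed (t , c , forbidden)))
      in t , c , inj₂ s

    finitelyCoherent⇒entailmentClosed : ∀ {K} → FinitelyCoherent 𝒮 K → EntailmentClosed K
    finitelyCoherent⇒entailmentClosed (_ , k2 , _ , k4 , _) {zero} W S _ E⊆ =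
      let _ , t , s , t₊ = E⊆ (T₊-coherent , λ ()) in k2 ｛ t ｝ S (k4 t t₊) λ { refl → s }
    finitelyCoherent⇒entailmentClosed (_ , k2 , k3 , _ , k5) {suc n} W S W⊆K E⊆ =
      k2 _ S (k3 _ (k5 n W W⊆K f f∈cl)) allowed⊆S
      where
        f : Choice 𝒮 W → Thing
        f σ = proj₁ (cl-image-meets E⊆ σ)
        f∈cl : ∀ σ → cl (image 𝒮 σ) (f σ)
        f∈cl σ = proj₁ (proj₂ (cl-image-meets E⊆ σ))
        allowed⊆S : Range f ∖ Forbidden ⊆ S
        allowed⊆S ((σ , refl) , allowed) = fromInj₂ (⊥-elim ∘ allowed) (proj₂ (proj₂ (cl-image-meets E⊆ σ)))

    InKfin⇒entailmentClosed : ∀ {K} → InKfin 𝒮 K → EntailmentClosed K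
    InKfin⇒entailmentClosed (inj₁ finitelyCoherent) = finitelyCoherent⇒entailmentClosed finitelyCoherent
    InKfin⇒entailmentClosed (inj₂ K≐AllSubsets) _ _ _ _ = proj₂ K≐AllSubsets (lift tt)

  Φ-mono : ∀ {K₁ K₂} → K₁ ⊆ K₂ → Φ 𝒮 K₁ ⊆ Φ 𝒮 K₂
  Φ-mono K₁⊆K₂ (n , W , W⊆K₁ , 𝔈≐E) = n , W , K₁⊆K₂ ∘ W⊆K₁ , 𝔈≐E

  ⊆Δ∘Φ : ∀ K → K ⊆ Δ 𝒮 (Φ 𝒮 K)
  ⊆Δ∘Φ K {S} s = 1 , _ , (λ _ → s) , DbarOf≐E S

  Δ∘Φ⊆ : ∀ {K} → EntailmentClosed K → Δ 𝒮 (Φ 𝒮 K) ⊆ K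
  Δ∘Φ⊆ closed (_ , W , W⊆K , DbarOf≐EW) = closed W _ W⊆K (proj₂ DbarOf≐EW)

  Δ∘Φ : ∀ {K} → EntailmentClosed K → Δ 𝒮 (Φ 𝒮 K) ≐ K
  Δ∘Φ {K} closed = Δ∘Φ⊆ closed , ⊆Δ∘Φ K

  Φ-⊆-reflecting : ∀ {K₁ K₂} → EntailmentClosed K₂ → Φ 𝒮 K₁ ⊆ Φ 𝒮 K₂ → K₁ ⊆ K₂
  Φ-⊆-reflecting {K₁} closed ΦK₁⊆ΦK₂ = Δ∘Φ⊆ closed ∘ ΦK₁⊆ΦK₂ ∘ ⊆Δ∘Φ K₁

  Φ-isFilter : ∀ {K} → EntailmentClosed K → IsFilter 𝒮 (Φ 𝒮 K)
  Φ-isFilter {K} closed = ⊆Efin , (E 𝒮 [] , 0 , [] , (λ ()) , ≐-refl) , upward , ∩-closed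
    where
      ⊆Efin : Φ 𝒮 K ⊆ Efin 𝒮
      ⊆Efin (n , W , _ , 𝔈≐E) = n , W , 𝔈≐E
      upward : ∀ 𝔞 𝔟 → Φ 𝒮 K 𝔞 → Efin 𝒮 𝔟 → 𝔞 ⊆ 𝔟 → Φ 𝒮 K 𝔟
      upward _ _ (_ , W , W⊆K , 𝔞≐EW) (m , V , 𝔟≐EV) 𝔞⊆𝔟 =
        m , V , (λ j → closed W (V j) W⊆K (E⊆DbarOf V j ∘ proj₁ 𝔟≐EV ∘ 𝔞⊆𝔟 ∘ proj₂ 𝔞≐EW)) , 𝔟≐EV
      ∩-closed : ∀ 𝔞 𝔟 → Φ 𝒮 K 𝔞 → Φ 𝒮 K 𝔟 → Φ 𝒮 K (𝔞 ∩ 𝔟)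
      ∩-closed _ _ (n , W , W⊆K , 𝔞≐EW) (m , V , V⊆K , 𝔟≐EV) =
        n + m , W ++ V , ++⁺ K W⊆K V⊆K , ≐-trans (∩-cong 𝔞≐EW 𝔟≐EV) (≐-sym (E-++ W V))

  Φ-proper : ∀ {K} → EntailmentClosed K → K1 𝒮 K → ¬ (Efin 𝒮 ⊆ Φ 𝒮 K)
  Φ-proper closed ∅∉K Efin⊆ΦK = ∅∉K (Δ∘Φ⊆ closed (Efin⊆ΦK (DbarOf∈Efin ∅)))

  Φ-MeetsT₊ : Φ 𝒮 (MeetsT₊ 𝒮) ≐ SingletonDbar 𝒮
  Φ-MeetsT₊ = (λ (_ , W , W⊆MeetsT₊ , 𝔈≐E) → ≐-trans 𝔈≐E (E-meetsT₊ W (lower ∘ W⊆MeetsT₊)))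
            , (λ 𝔈≐Dbar → 0 , [] , (λ ()) , ≐-trans 𝔈≐Dbar (≐-sym (E-meetsT₊ [] λ ())))

  Δ-SingletonDbar : Δ 𝒮 (SingletonDbar 𝒮) ≐ MeetsT₊ 𝒮
  Δ-SingletonDbar = (λ DbarOf≐Dbar → lift (Dbar⊆DbarOf⇒meetsT₊ (proj₂ DbarOf≐Dbar)))
                  , (λ (lift meets) → proj₁ , DbarOf-T₊ meets)

  module FilterProperties {𝓕 : Coll 𝒮} (isFilter : IsFilter 𝒮 𝓕) where

    ⊆Efin : 𝓕 ⊆ Efin 𝒮
    ⊆Efin = proj₁ isFilter

    upward : ∀ 𝔞 𝔟 → 𝓕 𝔞 → Efin 𝒮 𝔟 → 𝔞 ⊆ 𝔟 → 𝓕 𝔟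
    upward = proj₁ (proj₂ (proj₂ isFilter))

    ∩-closed : ∀ 𝔞 𝔟 → 𝓕 𝔞 → 𝓕 𝔟 → 𝓕 (𝔞 ∩ 𝔟)
    ∩-closed = proj₂ (proj₂ (proj₂ isFilter))

    Dbar∈ : 𝓕 (Dbar 𝒮)
    Dbar∈ = let 𝔞 , 𝔞∈𝓕 = proj₁ (proj₂ isFilter) in upward 𝔞 _ 𝔞∈𝓕 Dbar∈Efin (Efin⊆Dbar (⊆Efin 𝔞∈𝓕))

    E∈ : ∀ {n} (W : Vector (Subset 𝒮) n) → All (Δ 𝒮 𝓕) W → 𝓕 (E 𝒮 W)
    E∈ {zero} W _ = upward _ _ Dbar∈ (E∈Efin W) (λ coherent → coherent , λ ())
    E∈ {suc n} W W⊆Δ𝓕 =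
      upward _ _ (∩-closed _ _ (W⊆Δ𝓕 zero) (E∈ (W ∘ suc) (W⊆Δ𝓕 ∘ suc))) (E∈Efin W) (E-head-tail W)

    DbarOf-∅∈⇒improper : 𝓕 (DbarOf 𝒮 ∅) → Efin 𝒮 ⊆ 𝓕
    DbarOf-∅∈⇒improper ∅∈Δ𝓕 {𝔟} 𝔟∈Efin = upward _ 𝔟 ∅∈Δ𝓕 𝔟∈Efin (⊥-elim ∘ DbarOf-∅)

    Δ-finitelyCoherent : ¬ (Efin 𝒮 ⊆ 𝓕) → FinitelyCoherent 𝒮 (Δ 𝒮 𝓕)
    Δ-finitelyCoherent proper = k1 , k2 , k3 , k4 , k5
      where
        k1 : K1 𝒮 (Δ 𝒮 𝓕)
        k1 = proper ∘ DbarOf-∅∈⇒improper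
        k2 : K2 𝒮 (Δ 𝒮 𝓕)
        k2 S₁ S₂ S₁∈ S₁⊆S₂ = upward _ _ S₁∈ (DbarOf∈Efin S₂) (DbarOf-mono S₁⊆S₂)
        k3 : K3 𝒮 (Δ 𝒮 𝓕)
        k3 S S∈ = upward _ _ S∈ (DbarOf∈Efin _) (DbarOf-∖Forbidden S)
        k4 : K4 𝒮 (Δ 𝒮 𝓕)
        k4 t t₊ = upward _ _ Dbar∈ (DbarOf∈Efin _) (DbarOf-T₊ (t , refl , t₊))
        k5 : K5fin 𝒮 (Δ 𝒮 𝓕)
        k5 _ W W⊆Δ𝓕 f f∈cl = upward _ _ (E∈ W W⊆Δ𝓕) (DbarOf∈Efin _) (E⊆DbarOf-Range f f∈cl)

    Φ∘Δ : Φ 𝒮 (Δ 𝒮 𝓕) ≐ 𝓕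
    Φ∘Δ = (λ (n , W , W⊆Δ𝓕 , 𝔈≐E) → upward _ _ (E∈ W W⊆Δ𝓕) (n , W , 𝔈≐E) (proj₂ 𝔈≐E))
        , (λ 𝔈∈𝓕 → let n , W , 𝔈≐E = ⊆Efin 𝔈∈𝓕 in
             n , W , (λ i → upward _ _ 𝔈∈𝓕 (DbarOf∈Efin _) (E⊆DbarOf W i ∘ proj₁ 𝔈≐E)) , 𝔈≐E)

    isPrimeFilter⇔complete : ∀ {K} → ¬ (Efin 𝒮 ⊆ 𝓕) → 𝓕 ≐ Φ 𝒮 K → K ≐ Δ 𝒮 𝓕 →
                             IsPrimeFilter 𝒮 𝓕 ⇔ Complete 𝒮 K
    isPrimeFilter⇔complete {K} proper (_ , ΦK⊆𝓕) (K⊆Δ𝓕 , Δ𝓕⊆K) =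
      mk⇔ (λ (_ , prime) → prime⇒complete prime) (λ complete → (isFilter , proper) , complete⇒prime complete)
      where
        prime⇒complete : (∀ 𝔞 𝔟 → Efin 𝒮 𝔞 → Efin 𝒮 𝔟 → 𝓕 (𝔞 ∪ 𝔟) → 𝓕 𝔞 ⊎ 𝓕 𝔟) → Complete 𝒮 K
        prime⇒complete prime S₁ S₂ S₁∪S₂∈K =
          ⊎-map Δ𝓕⊆K Δ𝓕⊆K (prime _ _ (DbarOf∈Efin S₁) (DbarOf∈Efin S₂)
            (upward _ _ (K⊆Δ𝓕 S₁∪S₂∈K) (Efin-resp-≐ (DbarOf-∪ S₁ S₂) (DbarOf∈Efin (S₁ ∪ S₂)))
                    (proj₁ (DbarOf-∪ S₁ S₂))))
        complete⇒prime : Complete 𝒮 K → ∀ 𝔞 𝔟 → Efin 𝒮 𝔞 → Efin 𝒮 𝔟 → 𝓕 (𝔞 ∪ 𝔟) → 𝓕 𝔞 ⊎ 𝓕 𝔟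
        complete⇒prime complete _ _ (n , W , 𝔞≐EW) (m , V , 𝔟≐EV) 𝔞∪𝔟∈𝓕 =
          ⊎-map (λ W⊆K → ΦK⊆𝓕 (n , W , W⊆K , 𝔞≐EW)) (λ V⊆K → ΦK⊆𝓕 (m , V , V⊆K , 𝔟≐EV))
                (∀∀⊎⇒∀⊎∀ λ i j → complete (W i) (V j) (Δ𝓕⊆K (upward _ _ 𝔞∪𝔟∈𝓕 (DbarOf∈Efin _)
                  [ DbarOf-mono inj₁ ∘ E⊆DbarOf W i ∘ proj₁ 𝔞≐EW
                  , DbarOf-mono inj₂ ∘ E⊆DbarOf V j ∘ proj₁ 𝔟≐EV ])))

    Δ-InKfin : ExcludedMiddle 1ℓ → InKfin 𝒮 (Δ 𝒮 𝓕)
    Δ-InKfin em with em {𝓕 (DbarOf 𝒮 ∅)}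
    ... | yes ∅∈Δ𝓕 = inj₂ ((λ _ → lift tt) , λ {S} _ → DbarOf-∅∈⇒improper ∅∈Δ𝓕 (DbarOf∈Efin S))
    ... | no ∅∉Δ𝓕 = inj₁ (Δ-finitelyCoherent λ Efin⊆𝓕 → ∅∉Δ𝓕 (Efin⊆𝓕 (DbarOf∈Efin ∅)))

theorem5 : ExcludedMiddle 1ℓ → (𝒮 : Setup) →
    -- (i)
    (∀ K → FinitelyCoherent 𝒮 K → IsProperFilter 𝒮 (Φ 𝒮 K))
    -- (ii)
    × (∀ 𝓕 → IsProperFilter 𝒮 𝓕 → FinitelyCoherent 𝒮 (Δ 𝒮 𝓕))
    -- (iii)
    × (∀ K → FinitelyCoherent 𝒮 K → Δ 𝒮 (Φ 𝒮 K) ≐ K)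
    -- (iv)
    × (∀ 𝓕 → IsProperFilter 𝒮 𝓕 → Φ 𝒮 (Δ 𝒮 𝓕) ≐ 𝓕)
    -- (v)
    × (∀ K₁ K₂ → K₁ ⊆ K₂ → Φ 𝒮 K₁ ⊆ Φ 𝒮 K₂)
    -- (vi)
    × (∀ 𝓕₁ 𝓕₂ → 𝓕₁ ⊆ 𝓕₂ → Δ 𝒮 𝓕₁ ⊆ Δ 𝒮 𝓕₂)
    -- (vii)
    × (Φ 𝒮 (MeetsT₊ 𝒮) ≐ SingletonDbar 𝒮 × Φ 𝒮 (AllSubsets 𝒮) ≐ Efin 𝒮)
    -- (viii)
    × (Δ 𝒮 (SingletonDbar 𝒮) ≐ MeetsT₊ 𝒮 × Δ 𝒮 (Efin 𝒮) ≐ AllSubsets 𝒮)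
    -- order isomorphism Φ : (𝐊_fin, ⊆) ≅ (𝐅(𝐄_fin), ⊆) with inverse Δ
    × ((∀ K → InKfin 𝒮 K → IsFilter 𝒮 (Φ 𝒮 K))
       × (∀ 𝓕 → IsFilter 𝒮 𝓕 → InKfin 𝒮 (Δ 𝒮 𝓕))
       × (∀ K → InKfin 𝒮 K → Δ 𝒮 (Φ 𝒮 K) ≐ K)
       × (∀ 𝓕 → IsFilter 𝒮 𝓕 → Φ 𝒮 (Δ 𝒮 𝓕) ≐ 𝓕)
       × (∀ K₁ K₂ → InKfin 𝒮 K₁ → InKfin 𝒮 K₂ → (K₁ ⊆ K₂ ⇔ Φ 𝒮 K₁ ⊆ Φ 𝒮 K₂)))
    -- (ix)
    × (∀ 𝓕 K → IsProperFilter 𝒮 𝓕 → FinitelyCoherent 𝒮 K →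
         𝓕 ≐ Φ 𝒮 K → K ≐ Δ 𝒮 𝓕 → (IsPrimeFilter 𝒮 𝓕 ⇔ Complete 𝒮 K))
theorem5 em 𝒮 =
    (λ _ fc → Φ-isFilter (closed fc) , Φ-proper (closed fc) (proj₁ fc))
  , (λ _ (isFilter , proper) → FilterProperties.Δ-finitelyCoherent isFilter proper)
  , (λ _ fc → Δ∘Φ (closed fc))
  , (λ _ (isFilter , _) → FilterProperties.Φ∘Δ isFilter)
  , (λ _ _ → Φ-mono)
  , (λ _ _ 𝓕₁⊆𝓕₂ → 𝓕₁⊆𝓕₂)
  , (Φ-MeetsT₊ , (λ (n , W , _ , 𝔈≐E) → n , W , 𝔈≐E) , (λ (n , W , 𝔈≐E) → n , W , (λ _ → lift tt) , 𝔈≐E))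
  , (Δ-SingletonDbar , (λ _ → lift tt) , (λ {S} _ → DbarOf∈Efin S))
  , ( (λ _ k → Φ-isFilter (closedKfin k))
    , (λ _ isFilter → FilterProperties.Δ-InKfin isFilter em)
    , (λ _ k → Δ∘Φ (closedKfin k))
    , (λ _ isFilter → FilterProperties.Φ∘Δ isFilter)
    , (λ _ _ _ k₂ → mk⇔ Φ-mono (Φ-⊆-reflecting (closedKfin k₂))))
  , (λ _ _ (isFilter , proper) _ → FilterProperties.isPrimeFilter⇔complete isFilter proper)
  where
    open Correspondence 𝒮
    closed : ∀ {K} → FinitelyCoherent 𝒮 K → EntailmentClosed K
    closed = finitelyCoherent⇒entailmentClosed (lowerExcludedMiddle em)
    closedKfin : ∀ {K} → InKfin 𝒮 K → EntailmentClosed K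
    closedKfin = InKfin⇒entailmentClosed (lowerExcludedMiddle em)
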